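{- Let $n\ge 3$ and consider a partial coloring of an $n\times n$ square with colors from $\{1,2,\dots,2n-2\}$ that uniquely extends to $L(n,2n-2)$. Then there do not exist indices $k,l$ and colors $a,b,c$ such that either (i) the entries $(k+1,l+1),(k+1,l+2),(k+2,l+2),(k+2,l+3)$ are uncolored, with $a(k+1,l+1)=\{a\}$, $a(k+1,l+2)=\{a,b\}$, $a(k+2,l+2)=\{b,c\}$; or (ii) the entries $(k+1,l+1),(k+2,l+1),(k+2,l+2),(k+3,l+2)$ are uncolored, with $a(k+3,l+2)=\{a\}$, $a(k+2,l+2)=\{a,b\}$, $a(k+2,l+1)=\{b,c\}$.
   Context: Entry $(i,j)$ is the entry in row $i$ and column $j$ (all indices mentioned are assumed to lie in $\{1,\dots,n\}$). An $L(n,k)$ is an $n\times n$ square all of whose entries are colored with colors from a set of $k$ colors so that all entries in a common row, and all entries in a common column, have pairwise different colors. A partial coloring assigns colors to some entries; the others are uncolored. It uniquely extends to $L(n,k)$ if there is exactly one way to color the uncolored entries so as to obtain an $L(n,k)$. For an uncolored entry $(i,j)$ of a partial coloring using colors $\{1,\dots,k\}$, $a(i,j)$ denotes the set of available colors: those of the $k$ colors that do not appear on any colored entry of row $i$ or of column $j$. -}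

module Defs where

open import Data.Nat using (ℕ; suc; _*_; _∸_)
open import Data.Fin using (Fin; toℕ)
open import Data.Maybe using (Maybe; just; nothing)
open import Data.Product using (Σ; _×_; ∃-syntax)
open import Data.Sum using (_⊎_)
open import Relation.Binary.PropositionalEquality using (_≡_; _≢_)
open import Function.Bundles using (_⇔_)

-- Entry (i,j) of the paper (1-indexed) is the pair (i-1, j-1) : Fin n × Fin n.
-- Colors {1,…,k} are represented by Fin k (color c is the element c-1).

PartialColoring : ℕ → ℕ → Set
PartialColoring n k = Fin n → Fin n → Maybe (Fin k)

Coloring : ℕ → ℕ → Set
Coloring n k = Fin n → Fin n → Fin k

IsL : ∀ {n k} → Coloring n k → Set
IsL c = (∀ i j j′ → c i j ≡ c i j′ → j ≡ j′) × (∀ i i′ j → c i j ≡ c i′ j → i ≡ i′)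

Extends : ∀ {n k} → PartialColoring n k → Coloring n k → Set
Extends p c = ∀ i j x → p i j ≡ just x → c i j ≡ x

UniquelyExtends : ∀ {n k} → PartialColoring n k → Set
UniquelyExtends {n} {k} p =
  Σ (Coloring n k) λ c → IsL c × Extends p c ×
    (∀ c′ → IsL c′ → Extends p c′ → ∀ i j → c′ i j ≡ c i j)

Uncolored : ∀ {n k} → PartialColoring n k → Fin n → Fin n → Set
Uncolored p i j = p i j ≡ nothing

Available : ∀ {n k} → PartialColoring n k → Fin n → Fin n → Fin k → Set
Available p i j x = (∀ j′ → p i j′ ≢ just x) × (∀ i′ → p i′ j ≢ just x)

Avail₁ : ∀ {n k} → PartialColoring n k → Fin n → Fin n → Fin k → Set
Avail₁ p i j a = ∀ x → Available p i j x ⇔ (x ≡ a)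

Avail₂ : ∀ {n k} → PartialColoring n k → Fin n → Fin n → Fin k → Fin k → Set
Avail₂ p i j a b = ∀ x → Available p i j x ⇔ (x ≡ a ⊎ x ≡ b)

Next : ∀ {n} → Fin n → Fin n → Set
Next i j = toℕ j ≡ suc (toℕ i)

-- configuration (i): rows r₁=k+1, r₂=k+2; columns c₁=l+1, c₂=l+2, c₃=l+3
ConfigI : ∀ {n k} → PartialColoring n k → Set
ConfigI {n} {k} p =
  ∃[ r₁ ] ∃[ r₂ ] ∃[ c₁ ] ∃[ c₂ ] ∃[ c₃ ] ∃[ a ] ∃[ b ] Σ (Fin k) λ c →
    Next {n} r₁ r₂ × Next {n} c₁ c₂ × Next {n} c₂ c₃ ×
    Uncolored p r₁ c₁ × Uncolored p r₁ c₂ × Uncolored p r₂ c₂ × Uncolored p r₂ c₃ ×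
    Avail₁ p r₁ c₁ a × Avail₂ p r₁ c₂ a b × Avail₂ p r₂ c₂ b c

-- configuration (ii): rows r₁=k+1, r₂=k+2, r₃=k+3; columns c₁=l+1, c₂=l+2
ConfigII : ∀ {n k} → PartialColoring n k → Set
ConfigII {n} {k} p =
  ∃[ r₁ ] ∃[ r₂ ] ∃[ r₃ ] ∃[ c₁ ] ∃[ c₂ ] ∃[ a ] ∃[ b ] Σ (Fin k) λ c →
    Next {n} r₁ r₂ × Next {n} r₂ r₃ × Next {n} c₁ c₂ ×
    Uncolored p r₁ c₁ × Uncolored p r₂ c₁ × Uncolored p r₂ c₂ × Uncolored p r₃ c₂ ×
    Avail₁ p r₃ c₂ a × Avail₂ p r₂ c₂ a b × Avail₂ p r₂ c₁ b c

-- Every color unavailable at a cell occurs in the cross of that cell (the 2n - 2 other entries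
-- of its row and column), and distinct colors occupy distinct entries there.  With 2n - 2
-- colors, the cross of (k+1,l+1) in configuration (i) has room for the unavailable ones only
-- if the color y of (k+2,l+1) is missing from row k+1.  If y were also missing from column
-- l+2 it would be available at (k+1,l+2), hence y = b (a is absent from column l+1), yet b
-- is absent from row k+2.  So y occurs in column l+2 as well, and then the cross of
-- (k+2,l+2) holds y twice and has too little room.  Configuration (ii) is the transpose of
-- (i).
module Submission where

open import Defs
open import Data.Nat using (ℕ; _≤_; _*_; _∸_; _+_; _<_; suc; s≤s; z≤n)
open import Data.Nat.Properties using (+-suc; +-identityʳ; m∸n+n≡m; *-monoʳ-≤; ≤-reflexive; ≤-trans; <-trans; <⇒≱)
open import Data.Fin using (Fin; toℕ)
open import Data.Fin.Properties using (injective⇒≤; +↔⊎; any?; _≟_; <⇒≢)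
open import Data.Maybe using (Maybe; just; nothing)
open import Data.Maybe.Properties using (just-injective; ≡-dec)
open import Data.Product using (Σ; _,_; proj₁; proj₂; swap)
open import Data.Sum using (_⊎_; inj₁; inj₂; [_,_]′)
open import Data.Sum.Properties using (inj₂-injective)
open import Data.Vec using (Vec; []; _∷_; lookup)
open import Data.Vec.Relation.Unary.AllPairs using ([]; _∷_)
open import Data.Vec.Relation.Unary.All using ([]; _∷_)
open import Data.Vec.Relation.Unary.Unique.Propositional using (Unique)
open import Data.Vec.Relation.Unary.Unique.Propositional.Properties using (lookup-injective)
open import Data.Empty using (⊥; ⊥-elim)
open import Function using (_∘_; id)
open import Function.Bundles using (_↣_; mk↣; Injection; Equivalence; mk⇔; _⇔_)
open import Function.Definitions using (Injective)
open import Function.Construct.Composition using (_↣-∘_)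
open import Function.Properties.Inverse using (↔⇒↣; ↔-sym)
open import Relation.Nullary using (¬_; yes; no)
open import Relation.Binary.PropositionalEquality

disjoint-injections⇒≤ : ∀ {m m′ n} {B : Set} → B ↣ Fin n →
  (f : Fin m → B) (g : Fin m′ → B) → Injective _≡_ _≡_ f → Injective _≡_ _≡_ g →
  (∀ x y → f x ≢ g y) → m + m′ ≤ n
disjoint-injections⇒≤ ι f g f-inj g-inj disjoint =
  injective⇒≤ (Injection.injective (ι ↣-∘ (mk↣ [f,g]-injective ↣-∘ ↔⇒↣ +↔⊎)))
  where
  [f,g]-injective : Injective _≡_ _≡_ [ f , g ]′
  [f,g]-injective {inj₁ x} {inj₁ y} e = cong inj₁ (f-inj e)
  [f,g]-injective {inj₁ x} {inj₂ y} e = ⊥-elim (disjoint x y e)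
  [f,g]-injective {inj₂ x} {inj₁ y} e = ⊥-elim (disjoint y x (sym e))
  [f,g]-injective {inj₂ x} {inj₂ y} e = cong inj₂ (g-inj e)

nothing⇒≢just : ∀ {A : Set} {m : Maybe A} {x} → m ≡ nothing → m ≢ just x
nothing⇒≢just u e with trans (sym u) e
... | ()

-- inj₁ i′ stands for the entry (i′ , j) of the column of a cell (i , j), inj₂ j′ for the
-- entry (i , j′) of its row; the cell itself occurs twice.
CrossSlot : ℕ → Set
CrossSlot N = Fin N ⊎ Fin N

-- Each color is assigned an entry of the cross of (i , j) holding it, preferring the
-- column; an available color, which occurs nowhere in the cross, gets the uncolored
-- column entry  reserve x  instead.
module Cross {N k} (p : PartialColoring N k) (i j : Fin N) (reserve : Fin k → Fin N)
  (reserve-uncolored : ∀ x → Uncolored p (reserve x) j)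
  (reserve-injective : ∀ {x y} → Available p i j x → Available p i j y →
     reserve x ≡ reserve y → x ≡ y) where

  data Occupies (x : Fin k) : CrossSlot N → Set where
    column   : ∀ {i′} → p i′ j ≡ just x → Occupies x (inj₁ i′)
    row      : ∀ {j′} → p i j′ ≡ just x → (∀ i′ → p i′ j ≢ just x) → Occupies x (inj₂ j′)
    reserved : ∀ {i′} → Available p i j x → reserve x ≡ i′ → Occupies x (inj₁ i′)

  occupied-slot : ∀ x → Σ (CrossSlot N) (Occupies x)
  occupied-slot x with any? (λ i′ → ≡-dec _≟_ (p i′ j) (just x))
  ... | yes (i′ , e) = inj₁ i′ , column e
  ... | no ∉column with any? (λ j′ → ≡-dec _≟_ (p i j′) (just x))
  ...   | yes (j′ , e) = inj₂ j′ , row e (λ i′ e′ → ∉column (i′ , e′))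
  ...   | no ∉row = inj₁ (reserve x) ,
            reserved ((λ j′ e → ∉row (j′ , e)) , (λ i′ e → ∉column (i′ , e))) refl

  occupant-unique : ∀ {x y s} → Occupies x s → Occupies y s → x ≡ y
  occupant-unique (column e) (column e′) = just-injective (trans (sym e) e′)
  occupant-unique (row e _) (row e′ _) = just-injective (trans (sym e) e′)
  occupant-unique {y = y} (column e) (reserved _ refl) =
    ⊥-elim (nothing⇒≢just (reserve-uncolored y) e)
  occupant-unique {x = x} (reserved _ refl) (column e) =
    ⊥-elim (nothing⇒≢just (reserve-uncolored x) e)
  occupant-unique (reserved av refl) (reserved av′ e) = reserve-injective av av′ (sym e)

  uncolored-row-unoccupied : ∀ {j′ x} → Uncolored p i j′ → ¬ Occupies x (inj₂ j′)
  uncolored-row-unoccupied u (row e _) = nothing⇒≢just u e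

  unreserved-column-unoccupied : ∀ {i′ x} → Uncolored p i′ j → (∀ y → reserve y ≢ i′) →
    ¬ Occupies x (inj₁ i′)
  unreserved-column-unoccupied u _ (column e) = nothing⇒≢just u e
  unreserved-column-unoccupied _ unreserved (reserved _ e) = unreserved _ e

  unoccupied-slots⇒≤ : ∀ {m} (free : Vec (CrossSlot N) m) → Unique free →
    (∀ t {x} → ¬ Occupies x (lookup free t)) → k + m ≤ N + N
  unoccupied-slots⇒≤ free unique unoccupied =
    disjoint-injections⇒≤ (↔⇒↣ (↔-sym +↔⊎)) (proj₁ ∘ occupied-slot) (lookup free)
      (λ {x} {y} e → occupant-unique (proj₂ (occupied-slot x))
                                     (subst (Occupies y) (sym e) (proj₂ (occupied-slot y))))
      (λ {t} {t′} → lookup-injective unique t t′)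
      (λ x t e → unoccupied t (subst (Occupies x) e (proj₂ (occupied-slot x))))

-- Configuration (i) with adjacency weakened to distinctness, so that configuration (ii)
-- transposes into it.
record Staircase {N k} (p : PartialColoring N k) : Set where
  field
    r₁ r₂ c₁ c₂ c₃ : Fin N
    a b c : Fin k
    r₁≢r₂ : r₁ ≢ r₂
    c₁≢c₂ : c₁ ≢ c₂
    c₁≢c₃ : c₁ ≢ c₃
    c₂≢c₃ : c₂ ≢ c₃
    uncolored₁₁ : Uncolored p r₁ c₁
    uncolored₁₂ : Uncolored p r₁ c₂
    uncolored₂₂ : Uncolored p r₂ c₂
    uncolored₂₃ : Uncolored p r₂ c₃
    avail₁₁ : Avail₁ p r₁ c₁ a
    avail₁₂ : Avail₂ p r₁ c₂ a b
    avail₂₂ : Avail₂ p r₂ c₂ b c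

transpose : ∀ {N k} → PartialColoring N k → PartialColoring N k
transpose p i j = p j i

transpose-available : ∀ {N k} {p : PartialColoring N k} {i j} {P : Fin k → Set} →
  (∀ x → Available p i j x ⇔ P x) → ∀ x → Available (transpose p) j i x ⇔ P x
transpose-available h x = mk⇔ (Equivalence.to (h x) ∘ swap) (swap ∘ Equivalence.from (h x))

module _ {N k} {p : PartialColoring N k} (S : Staircase p) where
  open Staircase S
  open Equivalence using (to; from)

  cross₂₂-bound : ∀ {y i₀} → p r₂ c₁ ≡ just y → p i₀ c₂ ≡ just y → k + 3 ≤ N + N
  cross₂₂-bound {i₀ = i₀} e₂₁ e₀ =
    unoccupied-slots⇒≤ (inj₂ c₁ ∷ inj₂ c₂ ∷ inj₂ c₃ ∷ [])
      (((c₁≢c₂ ∘ inj₂-injective) ∷ (c₁≢c₃ ∘ inj₂-injective) ∷ [])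
        ∷ ((c₂≢c₃ ∘ inj₂-injective) ∷ []) ∷ [] ∷ [])
      λ { Fin.zero (row e ∉column) → ∉column i₀ (trans e₀ (trans (sym e₂₁) e))
        ; (Fin.suc Fin.zero) → uncolored-row-unoccupied uncolored₂₂
        ; (Fin.suc (Fin.suc Fin.zero)) → uncolored-row-unoccupied uncolored₂₃ }
    where
    reserve : Fin k → Fin N
    reserve x with x ≟ b
    ... | yes _ = r₁
    ... | no _ = r₂

    reserve-uncolored : ∀ x → Uncolored p (reserve x) c₂
    reserve-uncolored x with x ≟ b
    ... | yes _ = uncolored₁₂
    ... | no _ = uncolored₂₂

    available-≢b⇒≡c : ∀ {x} → Available p r₂ c₂ x → x ≢ b → x ≡ c
    available-≢b⇒≡c {x} av x≢b = [ ⊥-elim ∘ x≢b , id ]′ (to (avail₂₂ x) av)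

    reserve-injective : ∀ {x y} → Available p r₂ c₂ x → Available p r₂ c₂ y →
      reserve x ≡ reserve y → x ≡ y
    reserve-injective {x} {y} av av′ e with x ≟ b | y ≟ b
    ... | yes x≡b | yes y≡b = trans x≡b (sym y≡b)
    ... | yes _   | no _    = ⊥-elim (r₁≢r₂ e)
    ... | no _    | yes _   = ⊥-elim (r₁≢r₂ (sym e))
    ... | no x≢b  | no y≢b  = trans (available-≢b⇒≡c av x≢b) (sym (available-≢b⇒≡c av′ y≢b))

    open Cross p r₂ c₂ reserve reserve-uncolored reserve-injective

  cross₁₁-bound : (∀ {y} → p r₂ c₁ ≡ just y → ∀ i₀ → p i₀ c₂ ≢ just y) → k + 3 ≤ N + N
  cross₁₁-bound ∉column₂ =
    unoccupied-slots⇒≤ (inj₂ r₁ ∷ inj₁ c₂ ∷ inj₂ r₂ ∷ [])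
      (((λ ()) ∷ (r₁≢r₂ ∘ inj₂-injective) ∷ []) ∷ ((λ ()) ∷ []) ∷ [] ∷ [])
      λ { Fin.zero → uncolored-row-unoccupied uncolored₁₁
        ; (Fin.suc Fin.zero) → unreserved-column-unoccupied uncolored₁₂ (λ _ → c₁≢c₂)
        ; (Fin.suc (Fin.suc Fin.zero)) (row e ∉row₁) → color₂₁-occurs-in-row₁ e ∉row₁ }
    where
    open Cross (transpose p) c₁ r₁ (λ _ → c₁) (λ _ → uncolored₁₁)
      (λ {x} {y} av av′ _ → trans (to (avail₁₁ x) (swap av)) (sym (to (avail₁₁ y) (swap av′))))

    -- Otherwise that color is available at (r₁, c₂), so it is a or b; but a is absent
    -- from column c₁ and b from row r₂.
    color₂₁-occurs-in-row₁ : ∀ {x} → p r₂ c₁ ≡ just x → (∀ j′ → p r₁ j′ ≢ just x) → ⊥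
    color₂₁-occurs-in-row₁ {x} e ∉row₁ with to (avail₁₂ x) (∉row₁ , ∉column₂ e)
    ... | inj₁ refl = proj₂ (from (avail₁₁ x) refl) r₂ e
    ... | inj₂ refl = proj₁ (from (avail₂₂ x) (inj₁ refl)) c₁ e

  staircase⇒≤ : k + 3 ≤ N + N
  staircase⇒≤ with p r₂ c₁ in e₂₁
  ... | nothing = cross₁₁-bound (λ e → ⊥-elim (nothing⇒≢just e₂₁ e))
  ... | just y with any? (λ i₀ → ≡-dec _≟_ (p i₀ c₂) (just y))
  ...   | yes (i₀ , e₀) = cross₂₂-bound e₂₁ e₀
  ...   | no ∉column₂ = cross₁₁-bound
          (λ e i₀ e₀ → ∉column₂ (i₀ , trans e₀ (trans (sym e) e₂₁)))

next⇒< : ∀ {N} {i j : Fin N} → Next i j → toℕ i < toℕ j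
next⇒< e = ≤-reflexive (sym e)

next⇒≢ : ∀ {N} {i j : Fin N} → Next i j → i ≢ j
next⇒≢ = <⇒≢ ∘ next⇒<

next²⇒≢ : ∀ {N} {i j l : Fin N} → Next i j → Next j l → i ≢ l
next²⇒≢ e e′ = <⇒≢ (<-trans (next⇒< e) (next⇒< e′))

configI⇒staircase : ∀ {N k} {p : PartialColoring N k} → ConfigI p → Staircase p
configI⇒staircase (r₁ , r₂ , c₁ , c₂ , c₃ , a , b , c , r₁r₂ , c₁c₂ , c₂c₃ ,
                   u₁₁ , u₁₂ , u₂₂ , u₂₃ , av₁₁ , av₁₂ , av₂₂) = record
  { r₁ = r₁ ; r₂ = r₂ ; c₁ = c₁ ; c₂ = c₂ ; c₃ = c₃ ; a = a ; b = b ; c = c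
  ; r₁≢r₂ = next⇒≢ r₁r₂ ; c₁≢c₂ = next⇒≢ c₁c₂ ; c₁≢c₃ = next²⇒≢ c₁c₂ c₂c₃ ; c₂≢c₃ = next⇒≢ c₂c₃
  ; uncolored₁₁ = u₁₁ ; uncolored₁₂ = u₁₂ ; uncolored₂₂ = u₂₂ ; uncolored₂₃ = u₂₃
  ; avail₁₁ = av₁₁ ; avail₁₂ = av₁₂ ; avail₂₂ = av₂₂ }

configII⇒staircase : ∀ {N k} {p : PartialColoring N k} → ConfigII p → Staircase (transpose p)
configII⇒staircase {p = p} (r₁ , r₂ , r₃ , c₁ , c₂ , a , b , c , r₁r₂ , r₂r₃ , c₁c₂ ,
                            u₁₁ , u₂₁ , u₂₂ , u₃₂ , av₃₂ , av₂₂ , av₂₁) = record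
  { r₁ = c₂ ; r₂ = c₁ ; c₁ = r₃ ; c₂ = r₂ ; c₃ = r₁ ; a = a ; b = b ; c = c
  ; r₁≢r₂ = ≢-sym (next⇒≢ c₁c₂) ; c₁≢c₂ = ≢-sym (next⇒≢ r₂r₃)
  ; c₁≢c₃ = ≢-sym (next²⇒≢ r₁r₂ r₂r₃) ; c₂≢c₃ = ≢-sym (next⇒≢ r₁r₂)
  ; uncolored₁₁ = u₃₂ ; uncolored₁₂ = u₂₂ ; uncolored₂₂ = u₂₁ ; uncolored₂₃ = u₁₁
  ; avail₁₁ = transpose-available {p = p} av₃₂ ; avail₁₂ = transpose-available {p = p} av₂₂
  ; avail₂₂ = transpose-available {p = p} av₂₁ }

twice-minus-two-plus-three : ∀ {n} → 1 ≤ n → 2 * n ∸ 2 + 3 ≡ suc (n + n)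
twice-minus-two-plus-three {n} 1≤n = begin
  2 * n ∸ 2 + 3       ≡⟨ +-suc (2 * n ∸ 2) 2 ⟩
  suc (2 * n ∸ 2 + 2) ≡⟨ cong suc (m∸n+n≡m (*-monoʳ-≤ 2 1≤n)) ⟩
  suc (n + (n + 0))   ≡⟨ cong (suc ∘ (n +_)) (+-identityʳ n) ⟩
  suc (n + n)         ∎
  where open ≡-Reasoning

lemma3 : (n : ℕ) → 3 ≤ n → (p : PartialColoring n (2 * n ∸ 2)) →
    UniquelyExtends p → ¬ (ConfigI p ⊎ ConfigII p)
lemma3 n 3≤n p _ config =
  <⇒≱ too-many-colors
      ([ staircase⇒≤ ∘ configI⇒staircase , staircase⇒≤ ∘ configII⇒staircase ]′ config)
  where
  too-many-colors : n + n < 2 * n ∸ 2 + 3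
  too-many-colors = ≤-reflexive (sym (twice-minus-two-plus-three (≤-trans (s≤s z≤n) 3≤n)))
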